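{- Let $K\leq\mathrm{Aut}(Q_n)$ and $\Pi:=(Q_n)_K$. Then for every positive integer $\ell$ and every $x\in\mathbb{F}_2^n$, $$\Pi_\ell(x^K)\subseteq\{(x+e)^K : e\in\mathbb{F}_2^n,\ \mathrm{wt}(e)=\ell\}.$$
   Context: The $n$-cube $Q_n$ has vertex set $\mathbb{F}_2^n$, two vectors adjacent iff their Hamming distance is $1$; $\mathrm{Aut}(Q_n)=\mathbb{F}_2^n: S_n$ (translations and coordinate permutations). $\mathrm{wt}(e)$ is the number of non-zero coordinates of $e$. The normal quotient $(Q_n)_K$ is the simple graph whose vertices are the $K$-orbits $x^K$ on $\mathbb{F}_2^n$, distinct orbits adjacent iff some vertex of one is adjacent in $Q_n$ to some vertex of the other. For a graph $\Pi$ and vertex $u$, $\Pi_\ell(u)$ is the set of vertices at distance exactly $\ell$ from $u$. -}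

module Defs where

open import Data.Nat using (ℕ; zero; suc; _+_; _<_)
open import Data.Bool using (Bool; true; false; if_then_else_; _xor_)
open import Data.Fin using (Fin; zero)
import Data.Fin as Fin
open import Data.Fin.Permutation using (Permutation′; _⟨$⟩ʳ_; _⟨$⟩ˡ_; id; flip; _∘ₚ_)
open import Data.Product using (Σ; _×_; _,_; ∃; ∃-syntax)
open import Relation.Binary.PropositionalEquality using (_≡_)
open import Relation.Nullary using (¬_)

-- Vectors of F₂ⁿ, as functions Fin n → Bool (true = 1, xor = addition).
F2 : ℕ → Set
F2 n = Fin n → Bool

_⊕_ : ∀ {n} → F2 n → F2 n → F2 n
(x ⊕ y) i = x i xor y i

wt : ∀ {n} → F2 n → ℕ
wt {zero} e = 0
wt {suc n} e = (if e zero then 1 else 0) + wt {n} (λ i → e (Fin.suc i))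

QAdj : ∀ {n} → F2 n → F2 n → Set
QAdj x y = wt (x ⊕ y) ≡ 1

-- Aut(Q_n) = F₂ⁿ : S_n, an element (t , π) acting as  x ↦ (i ↦ x (π i) + t i).
Aut : ℕ → Set
Aut n = F2 n × Permutation′ n

act : ∀ {n} → Aut n → F2 n → F2 n
act (t , π) x i = x (π ⟨$⟩ʳ i) xor t i

idA : ∀ {n} → Aut n
idA = (λ _ → false) , id

-- composition: act (g ∘A h) = act g ∘ act h (pointwise)
_∘A_ : ∀ {n} → Aut n → Aut n → Aut n
(t₁ , π₁) ∘A (t₂ , π₂) = (λ i → t₂ (π₁ ⟨$⟩ʳ i) xor t₁ i) , (π₁ ∘ₚ π₂)

invA : ∀ {n} → Aut n → Aut n
invA (t , π) = (λ i → t (π ⟨$⟩ˡ i)) , flip π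

_≈A_ : ∀ {n} → Aut n → Aut n → Set
g ≈A h = ∀ x i → act g x i ≡ act h x i

record Subgroup (n : ℕ) : Set₁ where
  field
    mem    : Aut n → Set
    resp   : ∀ {g h} → g ≈A h → mem g → mem h
    has-id : mem idA
    has-∘  : ∀ {g h} → mem g → mem h → mem (g ∘A h)
    has-⁻¹ : ∀ {g} → mem g → mem (invA g)
open Subgroup public

-- y ∈ x^K, equivalently x^K = y^K (orbits of a group partition F₂ⁿ).
SameOrbit : ∀ {n} → Subgroup n → F2 n → F2 n → Set
SameOrbit K x y = ∃[ g ] (mem K g × (∀ i → act g x i ≡ y i))

-- Adjacency in the normal quotient Π = (Q_n)_K, on orbits given by representatives:
-- distinct orbits, some vertex of one adjacent in Q_n to some vertex of the other.
ΠAdj : ∀ {n} → Subgroup n → F2 n → F2 n → Set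
ΠAdj K x y = ¬ SameOrbit K x y ×
  ∃[ a ] ∃[ b ] (SameOrbit K x a × SameOrbit K y b × QAdj a b)

Walk : ∀ {n} → Subgroup n → ℕ → F2 n → F2 n → Set
Walk K zero x y = SameOrbit K x y
Walk K (suc m) x z = ∃[ y ] (ΠAdj K x y × Walk K m y z)

AtDist : ∀ {n} → Subgroup n → ℕ → F2 n → F2 n → Set
AtDist K ℓ x y = Walk K ℓ x y × (∀ m → m < ℓ → ¬ Walk K m x y)

-- A walk of length ℓ in Π from x^K to y^K lifts, edge by edge, to a walk in Q_n
-- from x to a vertex of y^K: K is made of cube automorphisms, so each quotient edge
-- can be moved to start at the current vertex.  Hence (x + e)^K = y^K for some e
-- with wt e ≤ ℓ.  Conversely, flipping the coordinates of any such e one at a time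
-- walks from x^K to (x + e)^K in at most wt e steps of Π, so wt e < ℓ would
-- contradict dist(x^K, y^K) = ℓ.
module Submission where

open import Defs
open import Data.Nat using (ℕ; _≤_)
open import Data.Product using (_×_; ∃-syntax)
open import Relation.Binary.PropositionalEquality using (_≡_)

open import Data.Nat using (zero; suc; _+_; z≤n; s≤s)
open import Data.Nat.Properties
  using (+-0-commutativeMonoid; +-commutativeSemigroup; ≤-refl; ≤-reflexive; ≤-trans;
         +-mono-≤; m≤n⇒m≤1+n; ≤-<-trans; m≤n⇒m<n∨m≡n; suc-injective)
open import Data.Bool using (Bool; true; false; if_then_else_; _xor_)
open import Data.Bool.Properties using (xor-assoc; xor-same; xor-identityʳ)
open import Data.Fin using (Fin)
import Data.Fin as Fin
open import Data.Fin.Permutation using (Permutation′; _⟨$⟩ʳ_; _⟨$⟩ˡ_; inverseʳ)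
open import Data.Product using (_,_; proj₁; proj₂)
open import Data.Sum using (inj₁; inj₂)
open import Data.Empty using (⊥-elim)
open import Relation.Nullary using (¬_)
open import Relation.Binary.PropositionalEquality using (_≗_; refl; sym; trans; cong; cong₂; module ≡-Reasoning)
open import Algebra.Properties.CommutativeMonoid.Sum +-0-commutativeMonoid using (sum; sum-permute)
open import Algebra.Properties.CommutativeSemigroup +-commutativeSemigroup using (interchange)

xor-cancelˡ : ∀ x y → x xor (x xor y) ≡ y
xor-cancelˡ x y = trans (sym (xor-assoc x x y)) (cong (_xor y) (xor-same x))

xor-cancelʳ : ∀ x y → (x xor y) xor y ≡ x
xor-cancelʳ x y = trans (xor-assoc x y y) (trans (cong (x xor_) (xor-same y)) (xor-identityʳ x))

xor-translation-invariant : ∀ x y t → (x xor t) xor (y xor t) ≡ x xor y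
xor-translation-invariant x y false = cong₂ _xor_ (xor-identityʳ x) (xor-identityʳ y)
xor-translation-invariant true  true  true = refl
xor-translation-invariant true  false true = refl
xor-translation-invariant false true  true = refl
xor-translation-invariant false false true = refl

0ᵥ : ∀ {n} → F2 n
0ᵥ _ = false

⊕-identityʳ : ∀ {n} (x : F2 n) → x ⊕ 0ᵥ ≗ x
⊕-identityʳ x i = xor-identityʳ (x i)

⊕-cancelˡ : ∀ {n} (x y : F2 n) → x ⊕ (x ⊕ y) ≗ y
⊕-cancelˡ x y i = xor-cancelˡ (x i) (y i)

⊕-cancelˡ-assoc : ∀ {n} (x y z : F2 n) → x ⊕ ((x ⊕ y) ⊕ z) ≗ y ⊕ z
⊕-cancelˡ-assoc x y z i = trans (sym (xor-assoc (x i) _ (z i))) (cong (_xor z i) (⊕-cancelˡ x y i))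

⊕-translation-invariant : ∀ {n} (x y t : F2 n) → (x ⊕ t) ⊕ (y ⊕ t) ≗ x ⊕ y
⊕-translation-invariant x y t i = xor-translation-invariant (x i) (y i) (t i)

unit : ∀ {n} → Fin n → F2 n
unit Fin.zero    Fin.zero    = true
unit Fin.zero    (Fin.suc j) = false
unit (Fin.suc i) Fin.zero    = false
unit (Fin.suc i) (Fin.suc j) = unit i j

bit : Bool → ℕ
bit b = if b then 1 else 0

bit-xor : ∀ a b → bit (a xor b) ≤ bit a + bit b
bit-xor true  true  = z≤n
bit-xor true  false = ≤-refl
bit-xor false b     = ≤-refl

wt-cong : ∀ {n} {e f : F2 n} → e ≗ f → wt e ≡ wt f
wt-cong {zero}  e≗f = refl
wt-cong {suc n} e≗f = cong₂ _+_ (cong bit (e≗f Fin.zero)) (wt-cong (λ i → e≗f (Fin.suc i)))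

wt-0ᵥ : ∀ {n} → wt (0ᵥ {n}) ≡ 0
wt-0ᵥ {zero}  = refl
wt-0ᵥ {suc n} = wt-0ᵥ {n}

wt≡0⇒≗0ᵥ : ∀ {n} (e : F2 n) → wt e ≡ 0 → e ≗ 0ᵥ
wt≡0⇒≗0ᵥ {suc n} e wt≡0 i with e Fin.zero in e₀
wt≡0⇒≗0ᵥ {suc n} e ()   i           | true
wt≡0⇒≗0ᵥ {suc n} e wt≡0 Fin.zero    | false = e₀
wt≡0⇒≗0ᵥ {suc n} e wt≡0 (Fin.suc i) | false = wt≡0⇒≗0ᵥ (λ j → e (Fin.suc j)) wt≡0 i

wt-unit : ∀ {n} (i : Fin n) → wt (unit i) ≡ 1
wt-unit {suc n} Fin.zero    = cong suc (wt-0ᵥ {n})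
wt-unit         (Fin.suc i) = wt-unit i

wt-sum : ∀ {n} (e : F2 n) → wt e ≡ sum (λ i → bit (e i))
wt-sum {zero}  e = refl
wt-sum {suc n} e = cong (bit (e Fin.zero) +_) (wt-sum (λ i → e (Fin.suc i)))

wt-permute : ∀ {n} (e : F2 n) (π : Permutation′ n) → wt (λ i → e (π ⟨$⟩ʳ i)) ≡ wt e
wt-permute e π = trans (wt-sum (λ i → e (π ⟨$⟩ʳ i))) (trans (sym (sum-permute (λ i → bit (e i)) π)) (sym (wt-sum e)))

wt-⊕-≤ : ∀ {n} (e f : F2 n) → wt (e ⊕ f) ≤ wt e + wt f
wt-⊕-≤ {zero}  e f = z≤n
wt-⊕-≤ {suc n} e f = ≤-trans
  (+-mono-≤ (bit-xor (e Fin.zero) (f Fin.zero)) (wt-⊕-≤ (λ i → e (Fin.suc i)) (λ i → f (Fin.suc i))))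
  (≤-reflexive (interchange (bit (e Fin.zero)) (bit (f Fin.zero)) _ _))

wt≡suc⇒wt-⊕-unit : ∀ {n} (e : F2 n) k → wt e ≡ suc k → ∃[ i ] (wt (e ⊕ unit i) ≡ k)
wt≡suc⇒wt-⊕-unit {suc n} e k wt≡1+k with e Fin.zero
... | true  = Fin.zero , trans (wt-cong (λ j → xor-identityʳ (e (Fin.suc j)))) (suc-injective wt≡1+k)
... | false with wt≡suc⇒wt-⊕-unit (λ j → e (Fin.suc j)) k wt≡1+k
...   | i , wt≡k = Fin.suc i , wt≡k

QAdj-⊕-unit : ∀ {n} (x : F2 n) i → QAdj x (x ⊕ unit i)
QAdj-⊕-unit x i = trans (wt-cong (⊕-cancelˡ x (unit i))) (wt-unit i)

QAdj-act : ∀ {n} (g : Aut n) (a b : F2 n) → QAdj a b → QAdj (act g a) (act g b)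
QAdj-act (t , π) a b adj =
  trans (wt-cong (⊕-translation-invariant (λ i → a (π ⟨$⟩ʳ i)) (λ i → b (π ⟨$⟩ʳ i)) t))
        (trans (wt-permute (a ⊕ b) π) adj)

QAdj-respˡ : ∀ {n} {x x′ y : F2 n} → x ≗ x′ → QAdj x y → QAdj x′ y
QAdj-respˡ {y = y} x≗x′ adj = trans (wt-cong (λ i → cong (_xor y i) (sym (x≗x′ i)))) adj

module _ {n} (K : Subgroup n) where

  open ≡-Reasoning

  SameOrbit-refl : ∀ x → SameOrbit K x x
  SameOrbit-refl x = idA , has-id K , ⊕-identityʳ x

  SameOrbit-act : ∀ {g} → mem K g → ∀ x → SameOrbit K x (act g x)
  SameOrbit-act g∈K x = _ , g∈K , λ i → refl

  SameOrbit-trans : ∀ x {y z} → SameOrbit K x y → SameOrbit K y z → SameOrbit K x z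
  SameOrbit-trans x ((t₁ , π₁) , g∈K , gx≗y) ((t₂ , π₂) , h∈K , hy≗z) =
    ((t₂ , π₂) ∘A (t₁ , π₁)) , has-∘ K h∈K g∈K ,
    λ i → trans (sym (xor-assoc (x (π₁ ⟨$⟩ʳ (π₂ ⟨$⟩ʳ i))) _ _))
                (trans (cong (_xor t₂ i) (gx≗y (π₂ ⟨$⟩ʳ i))) (hy≗z i))

  SameOrbit-sym : ∀ x {y} → SameOrbit K x y → SameOrbit K y x
  SameOrbit-sym x {y} ((t , π) , g∈K , gx≗y) = invA (t , π) , has-⁻¹ K g∈K , g⁻¹y≗x
    where
    g⁻¹y≗x : act (invA (t , π)) y ≗ x
    g⁻¹y≗x i = begin
      y (π ⟨$⟩ˡ i) xor t (π ⟨$⟩ˡ i)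
        ≡⟨ cong (_xor t (π ⟨$⟩ˡ i)) (sym (gx≗y (π ⟨$⟩ˡ i))) ⟩
      (x (π ⟨$⟩ʳ (π ⟨$⟩ˡ i)) xor t (π ⟨$⟩ˡ i)) xor t (π ⟨$⟩ˡ i)
        ≡⟨ xor-cancelʳ (x (π ⟨$⟩ʳ (π ⟨$⟩ˡ i))) (t (π ⟨$⟩ˡ i)) ⟩
      x (π ⟨$⟩ʳ (π ⟨$⟩ˡ i))
        ≡⟨ cong x (inverseʳ π) ⟩
      x i ∎

  SameOrbit-congˡ : ∀ {x x′ y} → x ≗ x′ → SameOrbit K x y → SameOrbit K x′ y
  SameOrbit-congˡ x≗x′ (g , g∈K , gx≗y) =
    g , g∈K , λ i → trans (cong (_xor proj₁ g i) (sym (x≗x′ (proj₂ g ⟨$⟩ʳ i)))) (gx≗y i)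

  ΠAdj-respˡ : ∀ x {x′} y → SameOrbit K x x′ → ΠAdj K x y → ΠAdj K x′ y
  ΠAdj-respˡ x {x′} y x~x′ (x≁y , a , b , x~a , y~b , adj) =
    (λ x′~y → x≁y (SameOrbit-trans x x~x′ x′~y)) ,
    a , b , SameOrbit-trans x′ (SameOrbit-sym x x~x′) x~a , y~b , adj

  Walk-respˡ : ∀ m x {x′ z} → SameOrbit K x x′ → Walk K m x z → Walk K m x′ z
  Walk-respˡ zero    x {x′} x~x′ x~z               = SameOrbit-trans x′ (SameOrbit-sym x x~x′) x~z
  Walk-respˡ (suc m) x      x~x′ (y , x—y , walk) = y , ΠAdj-respˡ x y x~x′ x—y , walk

  ΠAdj-lift : ∀ x y → ΠAdj K x y → ∃[ y′ ] (QAdj x y′ × SameOrbit K y y′)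
  ΠAdj-lift x y (_ , a , b , x~a , y~b , adj) with SameOrbit-sym x x~a
  ... | g , g∈K , ga≗x =
    act g b , QAdj-respˡ ga≗x (QAdj-act g a b adj) , SameOrbit-trans y y~b (SameOrbit-act g∈K b)

  Walk-lift : ∀ m x {z} → Walk K m x z → ∃[ e ] (wt e ≤ m × SameOrbit K (x ⊕ e) z)
  Walk-lift zero x x~z =
    0ᵥ , ≤-reflexive (wt-0ᵥ {n}) , SameOrbit-congˡ (λ i → sym (⊕-identityʳ x i)) x~z
  Walk-lift (suc m) x (y , x—y , walk) with ΠAdj-lift x y x—y
  ... | y′ , adj , y~y′ with Walk-lift m y′ (Walk-respˡ m y y~y′ walk)
  ...   | e , wt-e≤m , y′⊕e~z =
    (x ⊕ y′) ⊕ e , ≤-trans (wt-⊕-≤ (x ⊕ y′) e) (+-mono-≤ (≤-reflexive adj) wt-e≤m) ,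
    SameOrbit-congˡ (λ i → sym (⊕-cancelˡ-assoc x y′ e i)) y′⊕e~z

  -- Orbit membership need not be decidable, so "same orbit or a Π-edge" is not
  -- a case split; the missing shorter walk is taken as a hypothesis instead.
  Walk-extend : ∀ m {x x₁ z} → QAdj x x₁ → Walk K m x₁ z → ¬ Walk K m x z → Walk K (suc m) x z
  Walk-extend m {x} {x₁} adj walk no-walk =
    x₁ , ((λ x~x₁ → no-walk (Walk-respˡ m x₁ (SameOrbit-sym x x~x₁) walk)) ,
          x , x₁ , SameOrbit-refl x , SameOrbit-refl x₁ , adj) , walk

  ¬¬Walk≤wt : ∀ k (e : F2 n) → wt e ≡ k → ∀ x z → SameOrbit K (x ⊕ e) z →
              ¬ (∀ m → m ≤ k → ¬ Walk K m x z)
  ¬¬Walk≤wt zero e wt≡0 x z x⊕e~z no-walk =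
    no-walk 0 z≤n
      (SameOrbit-congˡ (λ i → trans (cong (x i xor_) (wt≡0⇒≗0ᵥ e wt≡0 i)) (xor-identityʳ (x i))) x⊕e~z)
  ¬¬Walk≤wt (suc k) e wt≡1+k x z x⊕e~z no-walk with wt≡suc⇒wt-⊕-unit e k wt≡1+k
  ... | i , wt≡k =
    ¬¬Walk≤wt k (e ⊕ unit i) wt≡k (x ⊕ unit i) z
      (SameOrbit-congˡ (λ j → sym (⊕-translation-invariant x e (unit i) j)) x⊕e~z)
      (λ m m≤k walk → no-walk (suc m) (s≤s m≤k)
        (Walk-extend m (QAdj-⊕-unit x i) walk (no-walk m (m≤n⇒m≤1+n m≤k))))

lemma3p1 : (n : ℕ) (K : Subgroup n) (ℓ : ℕ) → 1 ≤ ℓ → (x y : F2 n) →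
    AtDist K ℓ x y → ∃[ e ] (wt e ≡ ℓ × SameOrbit K (x ⊕ e) y)
lemma3p1 n K ℓ _ x y (walk , no-shorter-walk) with Walk-lift K ℓ x walk
... | e , wt-e≤ℓ , x⊕e~y with m≤n⇒m<n∨m≡n wt-e≤ℓ
...   | inj₂ wt-e≡ℓ = e , wt-e≡ℓ , x⊕e~y
...   | inj₁ wt-e<ℓ = ⊥-elim (¬¬Walk≤wt K (wt e) e refl x y x⊕e~y
                        (λ m m≤wt-e → no-shorter-walk m (≤-<-trans m≤wt-e wt-e<ℓ)))
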